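{- Let $\mathcal{A}=\{0,\ldots,n-1\}$ for some $n\in\mathbb{N}$ and let $\lceil\cdot\rceil:\mathcal{A}\rightarrow\{0,1\}^*$ be a Deflate coding. Then $$\sum_{i\in\mathcal{A},\ \lceil i\rceil\neq[\,]}2^{ -\operatorname{len}\lceil i\rceil}\le 1,$$ and equality holds if and only if there is some $k\in\mathcal{A}$ such that $\lceil k\rceil\in\{1\}^+$ (i.e. $\lceil k\rceil$ is a nonempty list consisting only of $1$s).
   Context: $\{0,1\}^*$ is the set of finite bit lists, $[\,]$ is the empty list, $::$ is cons, $+\!\!+$ is concatenation, $\{0,1\}^+$ is the set of nonempty bit lists. For bit lists $a,b$, write $a\preccurlyeq b$ ($a$ is a prefix of $b$) if there is $c\in\{0,1\}^*$ with $a+\!\!+c=b$. The lexicographical ordering $\sqsubseteq$ on $\{0,1\}^*$ is the least relation with $[\,]\sqsubseteq a$ for all $a$; $0::a\sqsubseteq 1::b$ for all $a,b$; and $j::a\sqsubseteq j::b$ whenever $a\sqsubseteq b$ (for $j\in\{0,1\}$). A Deflate coding is a map $\lceil\cdot\rceil:\mathcal{A}\to\{0,1\}^*$ such that: (1) for all $a\neq b$ with $\lceil a\rceil\neq[\,]$, $\lceil a\rceil\not\preccurlyeq\lceil b\rceil$; (2) for all $a,b$, if $\operatorname{len}\lceil a\rceil<\operatorname{len}\lceil b\rceil$ then $\lceil a\rceil\sqsubseteq\lceil b\rceil$; (3) for all $a,b$, if $\operatorname{len}\lceil a\rceil=\operatorname{len}\lceil b\rceil$ and $a\le b$ then $\lceil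 a\rceil\sqsubseteq\lceil b\rceil$; (4) for all $a\in\mathcal{A}$ and $l\in\{0,1\}^+$, if $l\sqsubseteq\lceil a\rceil$ and $\operatorname{len} l=\operatorname{len}\lceil a\rceil$, then there exists $b\in\mathcal{A}$ with $\lceil b\rceil\neq[\,]$ and $\lceil b\rceil\preccurlyeq l$. -}

module Defs where

open import Data.Bool using (Bool; true; false)
open import Data.List using (List; []; _∷_; _++_; length; foldr; allFin)
open import Data.Fin using (Fin)
import Data.Fin as F
open import Data.Nat using (ℕ; zero; suc)
import Data.Nat as N
open import Data.Product using (∃; _×_)
open import Data.Rational using (ℚ; 0ℚ; 1ℚ; ½; _+_; _*_)
open import Relation.Nullary using (¬_)
open import Relation.Binary.PropositionalEquality using (_≡_; _≢_)

-- Bits: false = 0, true = 1.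
Bits : Set
Bits = List Bool

_≼_ : Bits → Bits → Set
a ≼ b = ∃ λ c → a ++ c ≡ b

data _⊑_ : Bits → Bits → Set where
  []⊑   : ∀ {a} → [] ⊑ a
  0⊑1   : ∀ {a b} → (false ∷ a) ⊑ (true ∷ b)
  cons⊑ : ∀ {j a b} → a ⊑ b → (j ∷ a) ⊑ (j ∷ b)

record IsDeflateCoding (n : ℕ) (code : Fin n → Bits) : Set where
  field
    prefixFree     : ∀ a b → a ≢ b → code a ≢ [] → ¬ (code a ≼ code b)
    shorterFirst   : ∀ a b → length (code a) N.< length (code b) → code a ⊑ code b
    sameLenOrdered : ∀ a b → length (code a) ≡ length (code b) → a F.≤ b → code a ⊑ code b
    noGaps         : ∀ a (l : Bits) → l ≢ [] → l ⊑ code a → length l ≡ length (code a) →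
                     ∃ λ b → code b ≢ [] × code b ≼ l

pow½ : ℕ → ℚ
pow½ zero    = 1ℚ
pow½ (suc k) = ½ * pow½ k

weight : Bits → ℚ
weight []        = 0ℚ
weight (b ∷ bs)  = pow½ (length (b ∷ bs))

kraftSum : (n : ℕ) → (Fin n → Bits) → ℚ
kraftSum n code = foldr (λ i s → weight (code i) + s) 0ℚ (allFin n)

-- Let S be the list of nonempty codewords; prefix-freeness of the coding makes S a prefix-free list.
-- Splitting S by first bit gives two prefix-free lists of tails whose sums of 2^(-length) average
-- to that of S, so induction on a length bound D gives Kraft's inequality, with equality when S is complete at depth D
-- (every word of length D has a prefix in S).  Conversely, if the sum is 1 and D bounds all lengths,
-- a word of length D with no prefix in S could be added to S, pushing the sum above 1; taking that
-- word to be 1^D yields an all-ones codeword.  If some codeword is 1^m, every word of length m is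
-- ⊑ it, and the no-gaps property of a Deflate coding supplies a codeword prefix for each of them.

module Submission where

open import Defs
open import Data.Bool using (Bool; true; false)
import Data.Bool as Bool
open import Data.Empty using (⊥-elim)
open import Data.Fin using (Fin)
open import Data.List using (List; []; _∷_; length; foldr; allFin; replicate)
open import Data.List.Extrema.Nat using (argmax; f[xs]≤f[argmax])
open import Data.List.Membership.Propositional using (_∈_)
open import Data.List.Membership.Propositional.Properties using (∈-allFin)
open import Data.List.Properties using (length-replicate; ++-identityʳ)
open import Data.List.Relation.Unary.All as All using (All; []; _∷_)
open import Data.List.Relation.Unary.All.Properties using (All¬⇒¬Any; ¬Any⇒All¬)
open import Data.List.Relation.Unary.AllPairs using (AllPairs; []; _∷_)
open import Data.List.Relation.Unary.Any using (Any; here; there; any?)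
open import Data.List.Relation.Unary.Unique.Propositional using (Unique)
open import Data.List.Relation.Unary.Unique.Propositional.Properties using (allFin⁺)
open import Data.Nat as ℕ using (ℕ; zero; suc; s≤s; s≤s⁻¹)
import Data.Nat.Properties as ℕ
open import Data.Product using (∃; _×_; _,_; proj₁; proj₂; uncurry)
open import Data.Rational using (ℚ; 0ℚ; 1ℚ; ½; _+_; _*_; _<_; _≤_)
open import Data.Rational.Properties
  using (≤-refl; <-irrefl; nonNegative⁻¹; positive⁻¹; +-mono-≤; +-monoˡ-<; +-identityˡ;
         *-monoˡ-≤-nonNeg; *-monoʳ-<-pos; module ≤-Reasoning)
open import Data.Rational.Solver using (module +-*-Solver)
open import Data.Sum using (_⊎_; inj₁; inj₂)
open import Function using (case_of_)
open import Function.Bundles using (_⇔_; mk⇔)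
open import Relation.Nullary using (¬_; Dec; yes; no)
open import Relation.Binary.PropositionalEquality
  using (_≡_; _≢_; refl; sym; trans; cong; cong₂; subst; module ≡-Reasoning)

Incomparable : Bits → Bits → Set
Incomparable s t = ¬ (s ≼ t) × ¬ (t ≼ s)

PrefixFree : List Bits → Set
PrefixFree = AllPairs Incomparable

LengthsAtMost : ℕ → List Bits → Set
LengthsAtMost D = All (λ s → length s ℕ.≤ D)

CompleteAt : ℕ → List Bits → Set
CompleteAt D S = ∀ l → length l ≡ D → Any (_≼ l) S

maxLength : List Bits → ℕ
maxLength S = length (argmax length [] S)

lengthsAtMost-maxLength : ∀ S → LengthsAtMost (maxLength S) S
lengthsAtMost-maxLength = f[xs]≤f[argmax] []

weightSum : List Bits → ℚ
weightSum = foldr (λ s acc → pow½ (length s) + acc) 0ℚ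

[]≼ : ∀ t → [] ≼ t
[]≼ t = t , refl

≼-refl : ∀ s → s ≼ s
≼-refl s = [] , ++-identityʳ s

≼[]⇒≡[] : ∀ {s} → s ≼ [] → s ≡ []
≼[]⇒≡[] {[]}    _       = refl
≼[]⇒≡[] {_ ∷ _} (_ , ())

≼-∷⁺ : ∀ {b s t} → s ≼ t → (b ∷ s) ≼ (b ∷ t)
≼-∷⁺ (c , refl) = c , refl

≼-∷⁻ : ∀ {b b′ s t} → (b ∷ s) ≼ (b′ ∷ t) → b ≡ b′ × s ≼ t
≼-∷⁻ (c , refl) = refl , (c , refl)

≼∧length≤⇒≡ : ∀ {l s} → l ≼ s → length s ℕ.≤ length l → s ≡ l
≼∧length≤⇒≡ {[]}    ([]    , refl) _         = refl
≼∧length≤⇒≡ {[]}    (_ ∷ _ , refl) ()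
≼∧length≤⇒≡ {b ∷ l} (c     , refl) (s≤s le) = cong (b ∷_) (≼∧length≤⇒≡ (c , refl) le)

_≼?_ : ∀ s t → Dec (s ≼ t)
[]      ≼? t       = yes ([]≼ t)
(_ ∷ _) ≼? []      = no λ { (_ , ()) }
(b ∷ s) ≼? (b′ ∷ t) with b Bool.≟ b′ | s ≼? t
... | yes refl | yes s≼t = yes (≼-∷⁺ s≼t)
... | yes refl | no  s⋠t = no λ p → s⋠t (proj₂ (≼-∷⁻ p))
... | no  b≢b′ | _       = no λ p → b≢b′ (proj₁ (≼-∷⁻ p))

Incomparable-∷⁻ : ∀ {b s t} → Incomparable (b ∷ s) (b ∷ t) → Incomparable s t
Incomparable-∷⁻ (s⋠t , t⋠s) = (λ p → s⋠t (≼-∷⁺ p)) , (λ p → t⋠s (≼-∷⁺ p))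

pow½-positive : ∀ k → 0ℚ < pow½ k
pow½-positive zero    = positive⁻¹ 1ℚ
pow½-positive (suc k) = *-monoʳ-<-pos ½ (pow½-positive k)

subtree : Bool → List Bits → List Bits
subtree _     []                = []
subtree b     ([]          ∷ S) = subtree b S
subtree false ((false ∷ s) ∷ S) = s ∷ subtree false S
subtree false ((true  ∷ s) ∷ S) = subtree false S
subtree true  ((false ∷ s) ∷ S) = subtree true S
subtree true  ((true  ∷ s) ∷ S) = s ∷ subtree true S

subtree-All : ∀ b {P Q : Bits → Set} → (∀ {s} → P (b ∷ s) → Q s) →
              ∀ {S} → All P S → All Q (subtree b S)
subtree-All _     f []                          = []
subtree-All b     f {[]          ∷ _} (_ ∷ ps) = subtree-All b f ps
subtree-All false f {(false ∷ _) ∷ _} (p ∷ ps) = f p ∷ subtree-All false f ps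
subtree-All false f {(true  ∷ _) ∷ _} (_ ∷ ps) = subtree-All false f ps
subtree-All true  f {(false ∷ _) ∷ _} (_ ∷ ps) = subtree-All true f ps
subtree-All true  f {(true  ∷ _) ∷ _} (p ∷ ps) = f p ∷ subtree-All true f ps

subtree-prefixFree : ∀ b {S} → PrefixFree S → PrefixFree (subtree b S)
subtree-prefixFree _     []                           = []
subtree-prefixFree b     {[]          ∷ _} (_  ∷ pf) = subtree-prefixFree b pf
subtree-prefixFree false {(false ∷ _) ∷ _} (ps ∷ pf) =
  subtree-All false Incomparable-∷⁻ ps ∷ subtree-prefixFree false pf
subtree-prefixFree false {(true  ∷ _) ∷ _} (_  ∷ pf) = subtree-prefixFree false pf
subtree-prefixFree true  {(false ∷ _) ∷ _} (_  ∷ pf) = subtree-prefixFree true pf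
subtree-prefixFree true  {(true  ∷ _) ∷ _} (ps ∷ pf) =
  subtree-All true Incomparable-∷⁻ ps ∷ subtree-prefixFree true pf

subtree-lengthsAtMost : ∀ b D {S} → LengthsAtMost (suc D) S → LengthsAtMost D (subtree b S)
subtree-lengthsAtMost b D = subtree-All b s≤s⁻¹

subtree-Any : ∀ b l {S} → All (_≢ []) S → Any (_≼ (b ∷ l)) S → Any (_≼ l) (subtree b S)
subtree-Any b     l {[]          ∷ _} (s≢[] ∷ _) (here _)  = ⊥-elim (s≢[] refl)
subtree-Any b     l {[]          ∷ _} (_ ∷ ne)   (there a) = subtree-Any b l ne a
subtree-Any false l {(false ∷ _) ∷ _} _          (here p)  = here (proj₂ (≼-∷⁻ p))
subtree-Any false l {(false ∷ _) ∷ _} (_ ∷ ne)   (there a) = there (subtree-Any false l ne a)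
subtree-Any false l {(true  ∷ _) ∷ _} _          (here p)  = case proj₁ (≼-∷⁻ p) of λ ()
subtree-Any false l {(true  ∷ _) ∷ _} (_ ∷ ne)   (there a) = subtree-Any false l ne a
subtree-Any true  l {(false ∷ _) ∷ _} _          (here p)  = case proj₁ (≼-∷⁻ p) of λ ()
subtree-Any true  l {(false ∷ _) ∷ _} (_ ∷ ne)   (there a) = subtree-Any true l ne a
subtree-Any true  l {(true  ∷ _) ∷ _} _          (here p)  = here (proj₂ (≼-∷⁻ p))
subtree-Any true  l {(true  ∷ _) ∷ _} (_ ∷ ne)   (there a) = there (subtree-Any true l ne a)

subtree-complete : ∀ b D {S} → All (_≢ []) S → CompleteAt (suc D) S → CompleteAt D (subtree b S)
subtree-complete b D ne complete l refl = subtree-Any b l ne (complete (b ∷ l) refl)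

weightSum-subtrees : ∀ {S} → All (_≢ []) S →
                     weightSum S ≡ ½ * (weightSum (subtree false S) + weightSum (subtree true S))
weightSum-subtrees []                           = refl
weightSum-subtrees {[]          ∷ _} (s≢[] ∷ _) = ⊥-elim (s≢[] refl)
weightSum-subtrees {(false ∷ s) ∷ S} (_ ∷ ne)   =
  trans (cong (½ * pow½ (length s) +_) (weightSum-subtrees ne))
        (solve 4 (λ h w x y → h :* w :+ h :* (x :+ y) := h :* ((w :+ x) :+ y)) refl
               ½ (pow½ (length s)) (weightSum (subtree false S)) (weightSum (subtree true S)))
  where open +-*-Solver
weightSum-subtrees {(true  ∷ s) ∷ S} (_ ∷ ne)   =
  trans (cong (½ * pow½ (length s) +_) (weightSum-subtrees ne))
        (solve 4 (λ h w x y → h :* w :+ h :* (x :+ y) := h :* (x :+ (w :+ y))) refl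
               ½ (pow½ (length s)) (weightSum (subtree false S)) (weightSum (subtree true S)))
  where open +-*-Solver

nonEmpty⊎≡[[]] : ∀ {S} → PrefixFree S → All (_≢ []) S ⊎ S ≡ [] ∷ []
nonEmpty⊎≡[[]] []                                   = inj₁ []
nonEmpty⊎≡[[]] {[] ∷ []}    _                       = inj₂ refl
nonEmpty⊎≡[[]] {[] ∷ t ∷ _} ((([]⋠t , _) ∷ _) ∷ _) = ⊥-elim ([]⋠t ([]≼ t))
nonEmpty⊎≡[[]] {(b ∷ s) ∷ _} (ps ∷ pf) with nonEmpty⊎≡[[]] pf
... | inj₁ ne   = inj₁ ((λ ()) ∷ ne)
... | inj₂ refl with ps
...   | (_ , []⋠s) ∷ [] = ⊥-elim ([]⋠s ([]≼ (b ∷ s)))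

kraft-≤ : ∀ D {S} → PrefixFree S → LengthsAtMost D S → weightSum S ≤ 1ℚ
kraft-≤ D pf bounded with nonEmpty⊎≡[[]] pf
... | inj₂ refl = ≤-refl
kraft-≤ zero    {[]}          _  _        | inj₁ _          = nonNegative⁻¹ 1ℚ
kraft-≤ zero    {[] ∷ _}      _  _        | inj₁ (s≢[] ∷ _) = ⊥-elim (s≢[] refl)
kraft-≤ zero    {(_ ∷ _) ∷ _} _  (() ∷ _) | inj₁ _
kraft-≤ (suc D) {S}           pf bounded  | inj₁ ne         = begin
  weightSum S                                                   ≡⟨ weightSum-subtrees ne ⟩
  ½ * (weightSum (subtree false S) + weightSum (subtree true S)) ≤⟨ *-monoˡ-≤-nonNeg ½
                                                                      (+-mono-≤ (kraft-≤-subtree false)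
                                                                                (kraft-≤-subtree true)) ⟩
  ½ * (1ℚ + 1ℚ)                                                 ≡⟨⟩
  1ℚ                                                            ∎
  where
  open ≤-Reasoning
  kraft-≤-subtree : ∀ b → weightSum (subtree b S) ≤ 1ℚ
  kraft-≤-subtree b = kraft-≤ D (subtree-prefixFree b pf) (subtree-lengthsAtMost b D bounded)

complete⇒weightSum≡1 : ∀ D {S} → PrefixFree S → CompleteAt D S → weightSum S ≡ 1ℚ
complete⇒weightSum≡1 D pf complete with nonEmpty⊎≡[[]] pf
... | inj₂ refl = refl
complete⇒weightSum≡1 zero        pf complete | inj₁ ne =
  ⊥-elim (All¬⇒¬Any (All.map (λ s≢[] p → s≢[] (≼[]⇒≡[] p)) ne) (complete [] refl))
complete⇒weightSum≡1 (suc D) {S} pf complete | inj₁ ne = begin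
  weightSum S                                                   ≡⟨ weightSum-subtrees ne ⟩
  ½ * (weightSum (subtree false S) + weightSum (subtree true S)) ≡⟨ cong₂ (λ x y → ½ * (x + y))
                                                                        (subtree≡1 false) (subtree≡1 true) ⟩
  ½ * (1ℚ + 1ℚ)                                                 ≡⟨⟩
  1ℚ                                                            ∎
  where
  open ≡-Reasoning
  subtree≡1 : ∀ b → weightSum (subtree b S) ≡ 1ℚ
  subtree≡1 b = complete⇒weightSum≡1 D (subtree-prefixFree b pf) (subtree-complete b D ne complete)

weightSum≡1⇒complete : ∀ D {S} → PrefixFree S → LengthsAtMost D S →
                       weightSum S ≡ 1ℚ → CompleteAt D S
weightSum≡1⇒complete D {S} pf bounded sum≡1 l refl with any? (_≼? l) S
... | yes found = found
... | no  gap   = ⊥-elim (<-irrefl refl (begin-strict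
  1ℚ                      ≡⟨ sym (+-identityˡ 1ℚ) ⟩
  0ℚ + 1ℚ                 <⟨ +-monoˡ-< 1ℚ (pow½-positive (length l)) ⟩
  pow½ (length l) + 1ℚ    ≡⟨ cong (pow½ (length l) +_) (sym sum≡1) ⟩
  weightSum (l ∷ S)       ≤⟨ kraft-≤ (length l) (extended ∷ pf) (ℕ.≤-refl ∷ bounded) ⟩
  1ℚ                      ∎))
  where
  open ≤-Reasoning
  incomparable : ∀ {s} → length s ℕ.≤ length l → ¬ (s ≼ l) → Incomparable l s
  incomparable s≤l s⋠l =
    (λ l≼s → s⋠l (subst (_≼ l) (sym (≼∧length≤⇒≡ l≼s s≤l)) (≼-refl l))) , s⋠l
  extended : All (Incomparable l) S
  extended = All.zipWith (uncurry incomparable) (bounded , ¬Any⇒All¬ S gap)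

≼-replicate⇒All≡ : ∀ {s m b} → s ≼ replicate m b → All (_≡ b) s
≼-replicate⇒All≡ {[]}              _        = []
≼-replicate⇒All≡ {_ ∷ _} {zero}  (_ , ())
≼-replicate⇒All≡ {_ ∷ _} {suc m} p        with ≼-∷⁻ p
... | refl , s≼ = refl ∷ ≼-replicate⇒All≡ s≼

⊑-allTrue : ∀ {l o} → All (_≡ true) o → length l ℕ.≤ length o → l ⊑ o
⊑-allTrue {[]}                  _           _        = []⊑
⊑-allTrue {_ ∷ _}     {[]}    _           ()
⊑-allTrue {false ∷ _} {_ ∷ _} (refl ∷ _)  _        = 0⊑1
⊑-allTrue {true ∷ _}  {_ ∷ _} (refl ∷ ps) (s≤s le) = cons⊑ (⊑-allTrue ps le)

≢[]-sameLength : ∀ {l o : Bits} → o ≢ [] → length l ≡ length o → l ≢ []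
≢[]-sameLength {o = []}    o≢[] _  _    = o≢[] refl
≢[]-sameLength {o = _ ∷ _} _    () refl

module _ {n : ℕ} (code : Fin n → Bits) where

  codewords : List (Fin n) → List Bits
  codewords []       = []
  codewords (i ∷ is) with code i
  ... | []     = codewords is
  ... | c ∷ cs = (c ∷ cs) ∷ codewords is

  kraftSum≡weightSum : kraftSum n code ≡ weightSum (codewords (allFin n))
  kraftSum≡weightSum = go (allFin n)
    where
    go : ∀ is → foldr (λ i s → weight (code i) + s) 0ℚ is ≡ weightSum (codewords is)
    go []       = refl
    go (i ∷ is) with code i
    ... | []     = trans (+-identityˡ _) (go is)
    ... | c ∷ cs = cong (weight (c ∷ cs) +_) (go is)

  codewords-All⁺ : ∀ {P : Bits → Set} {Q : Fin n → Set} →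
                   (∀ i → Q i → code i ≢ [] → P (code i)) →
                   ∀ {is} → All Q is → All P (codewords is)
  codewords-All⁺ f []                = []
  codewords-All⁺ f {i ∷ _} (q ∷ qs) with code i | f i q
  ... | []    | _   = codewords-All⁺ f qs
  ... | _ ∷ _ | p   = p (λ ()) ∷ codewords-All⁺ f qs

  codewords-AllPairs : ∀ {R : Bits → Bits → Set} →
                       (∀ i j → i ≢ j → code i ≢ [] → code j ≢ [] → R (code i) (code j)) →
                       ∀ {is} → Unique is → AllPairs R (codewords is)
  codewords-AllPairs f []                = []
  codewords-AllPairs f {i ∷ _} (u ∷ us) with code i | f i
  ... | []    | _   = codewords-AllPairs f us
  ... | _ ∷ _ | r   = codewords-All⁺ (λ j i≢j → r j i≢j (λ ())) u ∷ codewords-AllPairs f us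

  codewords-Any⁺ : ∀ {P : Bits → Set} {is i} → i ∈ is → code i ≢ [] → P (code i) →
                   Any P (codewords is)
  codewords-Any⁺ {is = j ∷ _} (here refl) i≢[] p with code j
  ... | []    = ⊥-elim (i≢[] refl)
  ... | _ ∷ _ = here p
  codewords-Any⁺ {is = j ∷ _} (there i∈) i≢[] p with code j
  ... | []    = codewords-Any⁺ i∈ i≢[] p
  ... | _ ∷ _ = there (codewords-Any⁺ i∈ i≢[] p)

  codewords-Any⁻ : ∀ {P : Bits → Set} {is} → Any P (codewords is) →
                   ∃ λ k → code k ≢ [] × P (code k)
  codewords-Any⁻ {P} {j ∷ is} a with code j in eq
  ... | []    = codewords-Any⁻ {P} {is} a
  ... | c ∷ cs with a
  ...   | here p  = j , (λ j≡[] → case trans (sym eq) j≡[] of λ ()) , subst P (sym eq) p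
  ...   | there a = codewords-Any⁻ {P} {is} a

module _ {n : ℕ} {code : Fin n → Bits} (deflate : IsDeflateCoding n code) where
  open IsDeflateCoding deflate

  codewords-prefixFree : PrefixFree (codewords code (allFin n))
  codewords-prefixFree = codewords-AllPairs code incomparable (allFin⁺ n)
    where
    incomparable : ∀ i j → i ≢ j → code i ≢ [] → code j ≢ [] → Incomparable (code i) (code j)
    incomparable i j i≢j i≢[] j≢[] =
      prefixFree i j i≢j i≢[] , prefixFree j i (λ j≡i → i≢j (sym j≡i)) j≢[]

  allTrue⇒complete : ∀ {k} → code k ≢ [] → All (_≡ true) (code k) →
                     CompleteAt (length (code k)) (codewords code (allFin n))
  allTrue⇒complete {k} k≢[] allTrue l l≡k with noGaps k l (≢[]-sameLength k≢[] l≡k)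
                                                       (⊑-allTrue allTrue (ℕ.≤-reflexive l≡k)) l≡k
  ... | b , b≢[] , b≼l = codewords-Any⁺ code (∈-allFin b) b≢[] b≼l

  kraftSum≤1 : kraftSum n code ≤ 1ℚ
  kraftSum≤1 = subst (_≤ 1ℚ) (sym (kraftSum≡weightSum code))
                     (kraft-≤ _ codewords-prefixFree (lengthsAtMost-maxLength _))

  kraftSum≡1⇒allTrue : kraftSum n code ≡ 1ℚ → ∃ λ k → code k ≢ [] × All (_≡ true) (code k)
  kraftSum≡1⇒allTrue sum≡1 =
    let k , k≢[] , k≼ones = codewords-Any⁻ code {is = allFin n}
                              (complete (replicate D true) (length-replicate D))
    in  k , k≢[] , ≼-replicate⇒All≡ k≼ones
    where
    D = maxLength (codewords code (allFin n))
    complete : CompleteAt D (codewords code (allFin n))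
    complete = weightSum≡1⇒complete D codewords-prefixFree (lengthsAtMost-maxLength _)
                                    (trans (sym (kraftSum≡weightSum code)) sum≡1)

  allTrue⇒kraftSum≡1 : (∃ λ k → code k ≢ [] × All (_≡ true) (code k)) → kraftSum n code ≡ 1ℚ
  allTrue⇒kraftSum≡1 (k , k≢[] , allTrue) =
    trans (kraftSum≡weightSum code)
          (complete⇒weightSum≡1 _ codewords-prefixFree (allTrue⇒complete k≢[] allTrue))

theorem2 : (n : ℕ) (code : Fin n → Bits) → IsDeflateCoding n code →
           (kraftSum n code ≤ 1ℚ) ×
           (kraftSum n code ≡ 1ℚ ⇔ (∃ λ k → code k ≢ [] × All (_≡ true) (code k)))
theorem2 n code deflate =
  kraftSum≤1 deflate , mk⇔ (kraftSum≡1⇒allTrue deflate) (allTrue⇒kraftSum≡1 deflate)
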